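{- Let $T_h$ be the perfect binary tree of height $h = 3m + t \geq 4$, with $0 \leq t \leq 2$. Let $S \subseteq V(T_h)$ consist of: (1) all vertices at depth $h-1$; (2) all vertices at depths $h-2, h-5, \dots, 1+t$ (i.e. all depths $j$ with $1+t \le j \le h-2$ and $j \equiv h-2 \pmod 3$); (3) the root if $t = 0$ or $t = 1$, and the two vertices at depth $1$ if $t = 2$. Then $S$ is a multicover of $T_h$.
   Context: For a graph $G$, $d(u,v)$ is the distance, $\mathrm{ecc}(v)$ the eccentricity of $v$, and $N_r[v] = \{u : d(u,v) \le r\}$. A multicover of $G$ is a set $S \subseteq V(G)$ such that $|N_r[v]\cap S| \ge r$ for every $v \in V(G)$ and every $1 \le r \le \mathrm{ecc}(v)$. The perfect binary tree $T_h$ is the rooted tree in which every non-leaf vertex has exactly $2$ children and all leaves are at distance $h$ from the root; the depth of a vertex is its distance from the root (the paper calls this its height/level). -}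

module Defs where

open import Data.Nat using (ℕ; zero; suc; _+_; _∸_; _≤_; _≤ᵇ_; _≡ᵇ_; _⊔_)
open import Data.Nat.DivMod using (_%_)
open import Data.Bool using (Bool; true; false; _∧_; _∨_; if_then_else_)
open import Data.List using (List; []; _∷_; _++_; map; length; foldr)
open import Data.List.Membership.Propositional using (_∈_)

-- Vertices of the perfect binary tree T_h: binary words of length ≤ h.
-- The empty word is the root; the first letter is the choice made at the root,
-- so u is an ancestor of v iff u is a prefix of v. Depth = length.
verts : ℕ → List (List Bool)
verts zero    = [] ∷ []
verts (suc h) = [] ∷ (map (true ∷_) (verts h) ++ map (false ∷_) (verts h))

-- length of the longest common prefix (depth of the lowest common ancestor)
lcp : List Bool → List Bool → ℕ
lcp (true ∷ u)  (true ∷ v)  = suc (lcp u v)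
lcp (false ∷ u) (false ∷ v) = suc (lcp u v)
lcp _ _ = 0

-- graph distance in the tree: path through the lowest common ancestor
dist : List Bool → List Bool → ℕ
dist u v = (length u ∸ lcp u v) + (length v ∸ lcp u v)

ecc : ℕ → List Bool → ℕ
ecc h v = foldr (λ u m → dist u v ⊔ m) 0 (verts h)

ballCount : ℕ → (List Bool → Bool) → List Bool → ℕ → ℕ
ballCount h S v r =
  foldr (λ u n → if (dist u v ≤ᵇ r) ∧ S u then suc n else n) 0 (verts h)

IsMulticover : ℕ → (List Bool → Bool) → Set
IsMulticover h S = ∀ v → v ∈ verts h → ∀ r → 1 ≤ r → r ≤ ecc h v → r ≤ ballCount h S v r

inS : ℕ → ℕ → List Bool → Bool
inS h t v =
  let d = length v in
     (d ≡ᵇ (h ∸ 1))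
  ∨ ((suc t ≤ᵇ d) ∧ (d ≤ᵇ (h ∸ 2)) ∧ ((d % 3) ≡ᵇ ((h ∸ 2) % 3)))
  ∨ ((t ≤ᵇ 1) ∧ (d ≡ᵇ 0))
  ∨ ((t ≡ᵇ 2) ∧ (d ≡ᵇ 1))

{-# OPTIONS --safe #-}
-- Every level of S is full, and an ancestor w of v lying `up` levels above v has 2 ^ down
-- descendants `down` levels below it, all within distance up + down of v. So it suffices to
-- find, for every v and r, one or two such pairs (w, level of S) within reach r whose
-- descendant counts add up to at least r.
-- If depth v + r ≤ h: consecutive levels of S are at most 3 apart, so some level of S lies
-- between depths depth v + r - 2 and depth v + r; seen from v or from its parent it gives
-- at least 2 ^ (r - 1) ≥ r vertices (radii 2 and 3 at the root are checked by hand).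
-- Otherwise the ball reaches past the leaves. Writing r = 2s + 1 + p + (h - depth v) with
-- p ≤ 1, the ancestor s + 1 levels above v sees 2 ^ x vertices of level h - 1 and 2 ^ (x - 1)
-- of level h - 2, where x = s + h - depth v; when p = 1 and that ancestor is not the root,
-- its parent sees 2 ^ x vertices of level h - 2 instead. Either way the total is at least r.
module Submission where

open import Defs
open import Data.Bool using (Bool; true; false; T; _∧_; _∨_; if_then_else_)
open import Data.Bool.Properties using (T-∧)
open import Data.Empty using (⊥; ⊥-elim)
open import Data.List using (List; []; _∷_; _++_; map; length; foldr)
open import Data.List.Properties using (foldr-map)
open import Data.List.Membership.Propositional using (_∈_)
open import Data.List.Relation.Unary.All as All using (All; []; _∷_)
open import Data.List.Relation.Unary.All.Properties using (++⁺; map⁺)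
open import Data.Nat
open import Data.Nat.Properties
open import Data.Nat.DivMod using (_%_; _/_; m≡m%n+[m/n]*n; m%n<n; [m+kn]%n≡m%n; m<n*o⇒m/o<n)
open import Data.Nat.Tactic.RingSolver using (solve-∀)
open import Algebra.Properties.CommutativeSemigroup +-commutativeSemigroup using (x∙yz≈y∙xz)
open import Data.Product using (∃₂; _×_; _,_; proj₁)
open import Data.Sum using (_⊎_; inj₁; inj₂)
open import Function using (_∘_; Equivalence)
open import Relation.Binary.PropositionalEquality
open import Relation.Nullary using (yes; no)

open Equivalence using (to; from)

count : (List Bool → Bool) → List (List Bool) → ℕ
count p = foldr (λ u n → if p u then suc n else n) 0

count-∷ : ∀ p u us → count p us ≤ count p (u ∷ us)
count-∷ p u us with p u
... | true  = n≤1+n _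
... | false = ≤-refl

count-++ : ∀ p us vs → count p (us ++ vs) ≡ count p us + count p vs
count-++ p []       vs = refl
count-++ p (u ∷ us) vs with p u
... | true  = cong suc (count-++ p us vs)
... | false = count-++ p us vs

count-map : ∀ p f us → count p (map f us) ≡ count (p ∘ f) us
count-map p f = foldr-map _ f 0

count-mono : ∀ {p q} → (∀ u → T (p u) → T (q u)) → ∀ us → count p us ≤ count q us
count-mono p⇒q [] = z≤n
count-mono {p} {q} p⇒q (u ∷ us) with p u | q u | p⇒q u
... | true  | true  | _     = s≤s (count-mono p⇒q us)
... | true  | false | pu⇒qu = ⊥-elim (pu⇒qu _)
... | false | true  | _     = m≤n⇒m≤1+n (count-mono p⇒q us)
... | false | false | _     = count-mono p⇒q us

count-disjoint : ∀ {p q r} → (∀ u → T (p u) → T (r u)) → (∀ u → T (q u) → T (r u)) →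
                 (∀ u → T (p u) → T (q u) → ⊥) → ∀ us → count p us + count q us ≤ count r us
count-disjoint p⇒r q⇒r p#q [] = z≤n
count-disjoint {p} {q} {r} p⇒r q⇒r p#q (u ∷ us)
  with p u | q u | r u | p⇒r u | q⇒r u | p#q u | count-disjoint p⇒r q⇒r p#q us
... | true  | true  | _     | _     | _     | pu#qu | _  = ⊥-elim (pu#qu _ _)
... | true  | false | true  | _     | _     | _     | ih = s≤s ih
... | true  | false | false | pu⇒ru | _     | _     | _  = ⊥-elim (pu⇒ru _)
... | false | true  | true  | _     | _     | _     | ih =
  ≤-trans (≤-reflexive (+-suc (count p us) (count q us))) (s≤s ih)
... | false | true  | false | _     | qu⇒ru | _     | _  = ⊥-elim (qu⇒ru _)
... | false | false | true  | _     | _     | _     | ih = m≤n⇒m≤1+n ih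
... | false | false | false | _     | _     | _     | ih = ih

count-children : ∀ p h → count (p ∘ (true ∷_)) (verts h) + count (p ∘ (false ∷_)) (verts h)
                         ≤ count p (verts (suc h))
count-children p h = begin
  count (p ∘ (true ∷_)) (verts h) + count (p ∘ (false ∷_)) (verts h)
    ≡⟨ sym (cong₂ _+_ (count-map p (true ∷_) (verts h)) (count-map p (false ∷_) (verts h))) ⟩
  count p (map (true ∷_) (verts h)) + count p (map (false ∷_) (verts h))
    ≡⟨ sym (count-++ p (map (true ∷_) (verts h)) _) ⟩
  count p (map (true ∷_) (verts h) ++ map (false ∷_) (verts h))
    ≤⟨ count-∷ p [] (map (true ∷_) (verts h) ++ map (false ∷_) (verts h)) ⟩
  count p (verts (suc h)) ∎
  where open ≤-Reasoning

count-subtree : ∀ b p h → count (p ∘ (b ∷_)) (verts h) ≤ count p (verts (suc h))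
count-subtree true  p h = ≤-trans (m≤m+n _ (count (p ∘ (false ∷_)) (verts h))) (count-children p h)
count-subtree false p h = ≤-trans (m≤n+m _ (count (p ∘ (true ∷_)) (verts h))) (count-children p h)

2^j≤levelSize : ∀ {h j} → j ≤ h → 2 ^ j ≤ count (λ u → length u ≡ᵇ j) (verts h)
2^j≤levelSize {zero}  {zero}  _         = ≤-refl
2^j≤levelSize {suc h} {zero}  _         = s≤s z≤n
2^j≤levelSize {suc h} {suc j} (s≤s j≤h) =
  ≤-trans (+-mono-≤ ih (≤-trans (≤-reflexive (+-identityʳ (2 ^ j))) ih))
          (count-children (λ u → length u ≡ᵇ suc j) h)
  where ih = 2^j≤levelSize j≤h

verts-length≤ : ∀ h → All (λ u → length u ≤ h) (verts h)
verts-length≤ zero    = z≤n ∷ []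
verts-length≤ (suc h) = z≤n ∷ ++⁺ (map⁺ (All.map s≤s (verts-length≤ h)))
                                 (map⁺ (All.map s≤s (verts-length≤ h)))

∈verts⇒length≤ : ∀ {h v} → v ∈ verts h → length v ≤ h
∈verts⇒length≤ {h} = All.lookup (verts-length≤ h)

dist≤length+length : ∀ u v → dist u v ≤ length u + length v
dist≤length+length u v = +-mono-≤ (m∸n≤m (length u) (lcp u v)) (m∸n≤m (length v) (lcp u v))

ecc≤h+length : ∀ h v → ecc h v ≤ h + length v
ecc≤h+length h v = go (verts h) (verts-length≤ h)
  where
  go : ∀ us → All (λ u → length u ≤ h) us → foldr (λ u m → dist u v ⊔ m) 0 us ≤ h + length v
  go []       []           = z≤n
  go (u ∷ us) (u≤h ∷ us≤h) =
    ⊔-lub (≤-trans (dist≤length+length u v) (+-monoˡ-≤ (length v) u≤h)) (go us us≤h)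

inLevelBall : ℕ → List Bool → ℕ → List Bool → Bool
inLevelBall j v r u = (length u ≡ᵇ j) ∧ (dist u v ≤ᵇ r)

descendants-in-ball : ∀ {h r} k a x v → length v ≡ k + a → k + x ≤ h → a + x ≤ r →
                      2 ^ x ≤ count (inLevelBall (k + x) v r) (verts h)
descendants-in-ball {h} {r} zero a x v |v|≡a x≤h a+x≤r =
  ≤-trans (2^j≤levelSize x≤h) (count-mono near (verts h))
  where
  near : ∀ u → T (length u ≡ᵇ x) → T (inLevelBall x v r u)
  near u |u|≡x = from T-∧ (|u|≡x , ≤⇒≤ᵇ (begin
    dist u v              ≤⟨ dist≤length+length u v ⟩
    length u + length v   ≡⟨ cong₂ _+_ (≡ᵇ⇒≡ _ _ |u|≡x) |v|≡a ⟩
    x + a                 ≡⟨ +-comm x a ⟩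
    a + x                 ≤⟨ a+x≤r ⟩
    r                     ∎))
    where open ≤-Reasoning
descendants-in-ball {suc h} {r} (suc k) a x (true ∷ v) |v|≡ (s≤s k+x≤h) a+x≤r =
  ≤-trans (descendants-in-ball k a x v (suc-injective |v|≡) k+x≤h a+x≤r)
          (count-subtree true (inLevelBall (suc (k + x)) (true ∷ v) r) h)
descendants-in-ball {suc h} {r} (suc k) a x (false ∷ v) |v|≡ (s≤s k+x≤h) a+x≤r =
  ≤-trans (descendants-in-ball k a x v (suc-injective |v|≡) k+x≤h a+x≤r)
          (count-subtree false (inLevelBall (suc (k + x)) (false ∷ v) r) h)

FullLevel : (List Bool → Bool) → ℕ → Set
FullLevel S j = ∀ u → length u ≡ j → T (S u)

inLevelBall⇒inBall : ∀ {S j v r} → FullLevel S j →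
                     ∀ u → T (inLevelBall j v r u) → T ((dist u v ≤ᵇ r) ∧ S u)
inLevelBall⇒inBall full u p with to T-∧ p
... | |u|≡j , near = from T-∧ (near , full u (≡ᵇ⇒≡ _ _ |u|≡j))

levelBall≤ballCount : ∀ {h S j v r} → FullLevel S j →
                      count (inLevelBall j v r) (verts h) ≤ ballCount h S v r
levelBall≤ballCount {h} full = count-mono (inLevelBall⇒inBall full) (verts h)

levelBalls≤ballCount : ∀ {h S i j v r} → i ≢ j → FullLevel S i → FullLevel S j →
  count (inLevelBall i v r) (verts h) + count (inLevelBall j v r) (verts h) ≤ ballCount h S v r
levelBalls≤ballCount {h} {i = i} {j} {v} {r} i≢j fullᵢ fullⱼ =
  count-disjoint (inLevelBall⇒inBall fullᵢ) (inLevelBall⇒inBall fullⱼ) disjoint (verts h)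
  where
  depth : ∀ {k} u → T (inLevelBall k v r u) → length u ≡ k
  depth u p = ≡ᵇ⇒≡ _ _ (proj₁ (to T-∧ p))
  disjoint : ∀ u → T (inLevelBall i v r u) → T (inLevelBall j v r u) → ⊥
  disjoint u pᵢ pⱼ = i≢j (trans (sym (depth u pᵢ)) (depth u pⱼ))

-- The ancestor at depth apex of a vertex v of depth d, together with the level apex + down
-- of L: its 2 ^ down descendants on that level lie within distance up + down ≤ r of v.
record Probe (L : ℕ → Set) (h d r : ℕ) : Set where
  constructor probe
  field
    apex up down : ℕ
    depth≡    : d ≡ apex + up
    level≤h   : apex + down ≤ h
    up+down≤r : up + down ≤ r
    level∈L   : L (apex + down)

  level : ℕ
  level = apex + down

data Covered (L : ℕ → Set) (h d r : ℕ) : Set where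
  single : (P : Probe L h d r) → r ≤ 2 ^ Probe.down P → Covered L h d r
  double : (P Q : Probe L h d r) → Probe.level P ≢ Probe.level Q →
           r ≤ 2 ^ Probe.down P + 2 ^ Probe.down Q → Covered L h d r

probe-size : ∀ {h S v r} (P : Probe (FullLevel S) h (length v) r) →
             2 ^ Probe.down P ≤ count (inLevelBall (Probe.level P) v r) (verts h)
probe-size {v = v} (probe k a x |v|≡ k+x≤h a+x≤r _) = descendants-in-ball k a x v |v|≡ k+x≤h a+x≤r

covered⇒r≤ballCount : ∀ {h S v r} → Covered (FullLevel S) h (length v) r → r ≤ ballCount h S v r
covered⇒r≤ballCount {h} {S} {v} {r} (single P r≤) =
  ≤-trans r≤ (≤-trans (probe-size {v = v} P)
                      (levelBall≤ballCount {h} {S} {v = v} {r} (Probe.level∈L P)))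
covered⇒r≤ballCount {h} {S} {v} {r} (double P Q P≢Q r≤) =
  ≤-trans r≤ (≤-trans (+-mono-≤ (probe-size {v = v} P) (probe-size {v = v} Q))
                      (levelBalls≤ballCount {h} {S} {v = v} {r} P≢Q (Probe.level∈L P) (Probe.level∈L Q)))

n<2^n : ∀ n → n < 2 ^ n
n<2^n zero    = s≤s z≤n
n<2^n (suc n) = +-mono-≤ (m^n>0 2 n) (≤-trans (n<2^n n) (m≤m+n _ 0))

4+n≤2^[2+n] : ∀ n → 4 + n ≤ 2 ^ (2 + n)
4+n≤2^[2+n] n = +-mono-≤ (≤-trans (m≤m+n 2 n) (n<2^n (suc n))) (≤-trans (n<2^n (suc n)) (m≤m+n _ 0))

LevelWithin2Above : (ℕ → Set) → ℕ → Set
LevelWithin2Above L x = ∃₂ λ δ j → δ ≤ 2 × δ + j ≡ x × L j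

record CoveringLevels (h : ℕ) (L : ℕ → Set) : Set where
  field
    3≤h             : 3 ≤ h
    penultimate     : L (h ∸ 1)
    antepenultimate : L (h ∸ 2)
    dense           : ∀ {x} → 1 ≤ x → x ≤ h → LevelWithin2Above L x
    radius2AtRoot   : L 1 ⊎ L 2
    radius3AtRoot   : (L 0 × L 1) ⊎ L 2 ⊎ L 3

open CoveringLevels

descendantProbe : ∀ {L h d r x} → L (d + x) → d + x ≤ h → x ≤ r → Probe L h d r
descendantProbe {d = d} {x = x} full d+x≤h x≤r = probe d 0 x (sym (+-identityʳ d)) d+x≤h x≤r full

rootProbe : ∀ {L h r j} → L j → j ≤ r → r ≤ h → Probe L h 0 r
rootProbe full j≤r r≤h = descendantProbe full (≤-trans j≤r r≤h) j≤r

coverRadius2AtRoot : ∀ {L h} → L 1 ⊎ L 2 → 2 ≤ h → Covered L h 0 2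
coverRadius2AtRoot (inj₁ L₁) 2≤h = single (rootProbe L₁ (n≤1+n 1) 2≤h) (n<2^n 1)
coverRadius2AtRoot (inj₂ L₂) 2≤h = single (rootProbe L₂ ≤-refl 2≤h) (<⇒≤ (n<2^n 2))

coverRadius3AtRoot : ∀ {L h} → (L 0 × L 1) ⊎ L 2 ⊎ L 3 → 3 ≤ h → Covered L h 0 3
coverRadius3AtRoot (inj₁ (L₀ , L₁)) 3≤h =
  double (rootProbe L₀ z≤n 3≤h) (rootProbe L₁ (s≤s z≤n) 3≤h) (λ ()) ≤-refl
coverRadius3AtRoot (inj₂ (inj₁ L₂)) 3≤h = single (rootProbe L₂ (n≤1+n 2) 3≤h) (n<2^n 2)
coverRadius3AtRoot (inj₂ (inj₂ L₃)) 3≤h = single (rootProbe L₃ ≤-refl 3≤h) (<⇒≤ (n<2^n 3))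

coverNear : ∀ {L h d r} → CoveringLevels h L → 1 ≤ r → d + r ≤ h → Covered L h d r
coverNear {d = d} {r} C 1≤r d+r≤h with dense C (≤-trans 1≤r (m≤n+m r d)) d+r≤h
... | 0 , _ , _ , refl , full = single (descendantProbe full d+r≤h ≤-refl) (<⇒≤ (n<2^n r))
coverNear {L} {d = d} {suc r} C _ d+r≤h | 1 , j , _ , j≡ , full =
  single (descendantProbe (subst L (suc-injective (trans j≡ (+-suc d r))) full)
                          (≤-trans (+-monoʳ-≤ d (n≤1+n r)) d+r≤h) (n≤1+n r))
         (n<2^n r)
coverNear {L} {d = suc d} {suc r} C _ d+r≤h | 2 , j , _ , j≡ , full =
  single (probe d 1 r (+-comm 1 d)
                (≤-trans (≤-trans (n≤1+n _) (+-monoʳ-≤ (suc d) (n≤1+n r))) d+r≤h) ≤-refl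
                (subst L (suc-injective (suc-injective (trans j≡ (cong suc (+-suc d r))))) full))
         (n<2^n r)
coverNear {d = zero} C _ r≤h | 2 , zero , _ , refl , _ = coverRadius2AtRoot (radius2AtRoot C) r≤h
coverNear {d = zero} C _ r≤h | 2 , 1 , _ , refl , _ = coverRadius3AtRoot (radius3AtRoot C) r≤h
coverNear {d = zero} C _ r≤h | 2 , suc (suc j) , _ , refl , full =
  single (rootProbe full (m≤n+m _ 2) r≤h) (4+n≤2^[2+n] j)
coverNear C _ _ | suc (suc (suc _)) , _ , s≤s (s≤s ()) , _

-- A ball of radius r around a vertex of depth d reaching past the leaves of T_h:
-- r = p + 1 + 2s + (h - d), and m = s + (h - d) is the distance from the ancestor at
-- depth k = d - s - 1 down to level h - 1.
data Far (h d r : ℕ) : Set where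
  far : ∀ k s m p → s ≤ m → p ≤ 1 →
        h ≡ suc (k + m) → d ≡ k + suc s → r ≡ p + suc (s + m) → Far h d r

1+e+q≤d+e+d⇒q<d*2 : ∀ d e q → suc e + q ≤ d + e + d → q < d * 2
1+e+q≤d+e+d⇒q<d*2 d e q le =
  +-cancelˡ-≤ e (suc q) (d * 2) (subst₂ _≤_ (sym (+-suc e q)) (d+e+d≡e+d*2 d e) le)
  where
  d+e+d≡e+d*2 : ∀ d e → d + e + d ≡ e + d * 2
  d+e+d≡e+d*2 = solve-∀

far-view : ∀ {h d r} → d ≤ h → h < d + r → r ≤ h + d → Far h d r
far-view {d = d} d≤h h<d+r r≤h+d with m≤n⇒∃[o]m+o≡n d≤h
... | e , refl with m≤n⇒∃[o]m+o≡n (+-cancelˡ-< d e _ h<d+r)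
... | q , refl with m≤n⇒∃[o]m+o≡n (m<n*o⇒m/o<n {q} {d} {2} (1+e+q≤d+e+d⇒q<d*2 d e q r≤h+d))
... | k , refl =
  far k (q / 2) (q / 2 + e) (q % 2) (m≤m+n _ e) (s≤s⁻¹ (m%n<n q 2))
      (height≡ (q / 2) k e) (+-comm (suc (q / 2)) k)
      (trans (cong (suc e +_) (m≡m%n+[m/n]*n q 2)) (radius≡ e (q % 2) (q / 2)))
  where
  height≡ : ∀ s k e → suc s + k + e ≡ suc (k + (s + e))
  height≡ = solve-∀
  radius≡ : ∀ e p s → suc e + (p + s * 2) ≡ p + suc (s + (s + e))
  radius≡ = solve-∀

penultimateProbe : ∀ {L k s m p} → CoveringLevels (suc (k + m)) L →
                   Probe L (suc (k + m)) (k + suc s) (p + suc (s + m))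
penultimateProbe {k = k} {s} {m} {p} C = probe k (suc s) m refl (n≤1+n _) (m≤n+m _ p) (penultimate C)

antepenultimateProbe : ∀ {L k s n p} → CoveringLevels (suc (k + suc n)) L →
                       Probe L (suc (k + suc n)) (k + suc s) (p + suc (s + suc n))
antepenultimateProbe {L} {k} {s} {n} {p} C =
  probe k (suc s) n refl (≤-trans (+-monoʳ-≤ k (n≤1+n n)) (n≤1+n _))
        (≤-trans (s≤s (+-monoʳ-≤ s (n≤1+n n))) (m≤n+m _ p))
        (subst L (cong pred (+-suc k n)) (antepenultimate C))

antepenultimateProbe↑ : ∀ {L k s m} → CoveringLevels (suc (suc k + m)) L →
                        Probe L (suc (suc k + m)) (suc k + suc s) (1 + suc (s + m))
antepenultimateProbe↑ {k = k} {s} {m} C =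
  probe k (suc (suc s)) m (sym (+-suc k (suc s))) (≤-trans (n≤1+n _) (n≤1+n _)) ≤-refl (antepenultimate C)

coverFar : ∀ {L h d r} → CoveringLevels h L → Far h d r → Covered L h d r
coverFar C (far _ .0 zero _ z≤n z≤n refl refl refl) = single (penultimateProbe {s = 0} {p = 0} C) ≤-refl
coverFar C (far k s (suc n) _ s≤m z≤n refl refl refl) =
  double (penultimateProbe {s = s} {p = 0} C) (antepenultimateProbe {s = s} {p = 0} C)
         (1+n≢n ∘ +-cancelˡ-≡ k _ _)
         (≤-trans (s≤s (+-monoˡ-≤ (suc n) s≤m)) (+-mono-≤ (n<2^n (suc n)) (n<2^n n)))
coverFar C (far (suc k) s m _ s≤m (s≤s z≤n) refl refl refl) =
  double (penultimateProbe {s = s} {p = 1} C) (antepenultimateProbe↑ C) 1+n≢n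
         (begin
           suc (suc (s + m)) ≤⟨ s≤s (s≤s (+-monoˡ-≤ m s≤m)) ⟩
           suc (suc (m + m)) ≡⟨ cong suc (sym (+-suc m m)) ⟩
           suc m + suc m     ≤⟨ +-mono-≤ (n<2^n m) (n<2^n m) ⟩
           2 ^ m + 2 ^ m     ∎)
  where open ≤-Reasoning
coverFar C (far zero s m _ s≤m (s≤s z≤n) refl refl refl) with 3≤h C
... | s≤s (s≤s (s≤s {n = n} _)) =
  double (penultimateProbe {k = 0} {s} {p = 1} C) (antepenultimateProbe {k = 0} {s} {p = 1} C) 1+n≢n
         (≤-trans (s≤s (s≤s (+-monoˡ-≤ (suc (suc n)) s≤m))) (+-mono-≤ (4+n≤2^[2+n] n) (n<2^n (suc n))))

cover : ∀ {L h d r} → CoveringLevels h L → d ≤ h → 1 ≤ r → r ≤ h + d → Covered L h d r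
cover {h = h} {d} {r} C d≤h 1≤r r≤h+d with d + r ≤? h
... | yes d+r≤h = coverNear C 1≤r d+r≤h
... | no  d+r≰h = coverFar C (far-view d≤h (≰⇒> d+r≰h) r≤h+d)

coveringLevels⇒multicover : ∀ {h S} → CoveringLevels h (FullLevel S) → IsMulticover h S
coveringLevels⇒multicover {h} C v v∈ r 1≤r r≤ecc =
  covered⇒r≤ballCount (cover C (∈verts⇒length≤ v∈) 1≤r (≤-trans r≤ecc (ecc≤h+length h v)))

∨-introˡ : ∀ a b → T a → T (a ∨ b)
∨-introˡ true _ _ = _

∨-introʳ : ∀ a b → T b → T (a ∨ b)
∨-introʳ true  _ _ = _
∨-introʳ false _ p = p

∧-intro : ∀ a b → T a → T b → T (a ∧ b)
∧-intro true true _ _ = _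

inS-top : ∀ {h t} → FullLevel (inS h t) (h ∸ 1)
inS-top {h} u |u|≡ = ∨-introˡ _ _ (≡⇒≡ᵇ (length u) (h ∸ 1) |u|≡)

inS-middle : ∀ {h t j} → suc t ≤ j → j ≤ h ∸ 2 → j % 3 ≡ (h ∸ 2) % 3 → FullLevel (inS h t) j
inS-middle {h} t<j j≤h∸2 j≡h∸2 u refl =
  ∨-introʳ (length u ≡ᵇ h ∸ 1) _
    (∨-introˡ _ _ (∧-intro _ _ (≤⇒≤ᵇ t<j) (∧-intro _ _ (≤⇒≤ᵇ j≤h∸2) (≡⇒≡ᵇ _ _ j≡h∸2))))

inS-root : ∀ {h t} → t ≤ 1 → FullLevel (inS h t) 0
inS-root {h} z≤n       [] _ = ∨-introʳ (0 ≡ᵇ h ∸ 1) _ _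
inS-root {h} (s≤s z≤n) [] _ = ∨-introʳ (0 ≡ᵇ h ∸ 1) _ _

inS-depth1 : ∀ {h} → FullLevel (inS h 2) 1
inS-depth1 {h} (_ ∷ []) _ = ∨-introʳ (1 ≡ᵇ h ∸ 1) _ _

inS-radius2 : ∀ {h t} → t ≤ 2 → FullLevel (inS h t) (suc t) →
              FullLevel (inS h t) 1 ⊎ FullLevel (inS h t) 2
inS-radius2     z≤n             L₁ = inj₁ L₁
inS-radius2     (s≤s z≤n)       L₂ = inj₂ L₂
inS-radius2 {h} (s≤s (s≤s z≤n)) _  = inj₁ (inS-depth1 {h})

inS-radius3 : ∀ {h t} → t ≤ 2 → FullLevel (inS h t) (suc t) →
              (FullLevel (inS h t) 0 × FullLevel (inS h t) 1) ⊎ FullLevel (inS h t) 2 ⊎ FullLevel (inS h t) 3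
inS-radius3 {h} z≤n             L₁ = inj₁ (inS-root {h} z≤n , L₁)
inS-radius3     (s≤s z≤n)       L₂ = inj₂ (inj₁ L₂)
inS-radius3     (s≤s (s≤s z≤n)) L₃ = inj₂ (inj₂ L₃)

inS-dense-below : ∀ {h t x} → 1 ≤ x → x ≤ t → t ≤ 2 → LevelWithin2Above (FullLevel (inS h t)) x
inS-dense-below {h} (s≤s z≤n) (s≤s z≤n) (s≤s z≤n) =
  1 , 0 , s≤s z≤n , refl , inS-root {h} ≤-refl
inS-dense-below {h} (s≤s z≤n) (s≤s z≤n) (s≤s (s≤s z≤n)) =
  0 , 1 , z≤n , refl , inS-depth1 {h}
inS-dense-below {h} (s≤s z≤n) (s≤s (s≤s z≤n)) (s≤s (s≤s z≤n)) =
  1 , 1 , s≤s z≤n , refl , inS-depth1 {h}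

inS-coveringLevels : ∀ t m′ → t ≤ 2 →
                     CoveringLevels (3 + (t + m′ * 3)) (FullLevel (inS (3 + (t + m′ * 3)) t))
inS-coveringLevels t m′ t≤2 = record
  { 3≤h             = s≤s (s≤s (s≤s z≤n))
  ; penultimate     = inS-top {h}
  ; antepenultimate = antepenultimate′
  ; dense           = dense′
  ; radius2AtRoot   = inS-radius2 {h} t≤2 lowest
  ; radius3AtRoot   = inS-radius3 {h} t≤2 lowest
  }
  where
  g h : ℕ
  g = suc t + m′ * 3
  h = 2 + g
  L : ℕ → Set
  L = FullLevel (inS h t)

  g%3≡ : g % 3 ≡ suc t % 3
  g%3≡ = [m+kn]%n≡m%n (suc t) m′ 3

  antepenultimate′ : L g
  antepenultimate′ = inS-middle {h} (m≤m+n _ _) ≤-refl refl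

  lowest : L (suc t)
  lowest = inS-middle {h} ≤-refl (m≤m+n _ _) (sym g%3≡)

  progression : ∀ {x} → suc t ≤ x → x ≤ g → LevelWithin2Above L x
  progression {x} t<x x≤g = y % 3 , j , s≤s⁻¹ (m%n<n y 3) , δ+j≡x ,
    inS-middle {h} (m≤m+n _ _) (≤-trans (≤-trans (m≤n+m j (y % 3)) (≤-reflexive δ+j≡x)) x≤g)
               (trans ([m+kn]%n≡m%n (suc t) (y / 3) 3) (sym g%3≡))
    where
    y = x ∸ suc t
    j = suc t + y / 3 * 3
    δ+j≡x : y % 3 + j ≡ x
    δ+j≡x = begin
      y % 3 + (suc t + y / 3 * 3) ≡⟨ x∙yz≈y∙xz (y % 3) (suc t) _ ⟩
      suc t + (y % 3 + y / 3 * 3) ≡⟨ cong (suc t +_) (sym (m≡m%n+[m/n]*n y 3)) ⟩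
      suc t + y                   ≡⟨ m+[n∸m]≡n t<x ⟩
      x                           ∎
      where open ≡-Reasoning

  dense′ : ∀ {x} → 1 ≤ x → x ≤ 2 + g → LevelWithin2Above L x
  dense′ {x} 1≤x x≤h with x ≤? t | x ≤? g
  ... | yes x≤t | _       = inS-dense-below {h} 1≤x x≤t t≤2
  ... | no  x≰t | yes x≤g = progression (≰⇒> x≰t) x≤g
  ... | no  _   | no  x≰g =
    x ∸ g , g , m≤n+o⇒m∸n≤o x g (subst (x ≤_) (+-comm 2 g) x≤h) , m∸n+n≡m (<⇒≤ (≰⇒> x≰g)) ,
    antepenultimate′

mainTheorem8 : (m t : ℕ) → t ≤ 2 → 4 ≤ 3 * m + t →
    IsMulticover (3 * m + t) (inS (3 * m + t) t)
-- 4 ≤ h only serves to exclude m = 0.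
mainTheorem8 zero t t≤2 4≤t with ≤-trans 4≤t t≤2
... | s≤s (s≤s ())
mainTheorem8 (suc m′) t t≤2 _ =
  subst (λ h → IsMulticover h (inS h t)) (height≡ t m′)
        (coveringLevels⇒multicover (inS-coveringLevels t m′ t≤2))
  where
  height≡ : ∀ t m′ → 3 + (t + m′ * 3) ≡ 3 * suc m′ + t
  height≡ = solve-∀
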